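{- Let $\lambda=[\lambda_1,\dots,\lambda_k]\vdash n$. (1) If $\lambda_1>\frac n2$, then $p_1(\lambda)>\frac{n^2}{4}$. (2) $-n^2+2n\leq p_1(\lambda)$.
   Context: For $\lambda=[\lambda_1,\dots,\lambda_k]\vdash n$, let $2\lambda=[2\lambda_1,\dots,2\lambda_k]\vdash 2n$. The content of the box in row $i$ and column $j$ of a Young diagram is $j-i$. $p_1(\lambda)$ denotes the sum of the contents of all $2n$ boxes of the Young diagram of $2\lambda$ (i.e. the power sum $p_1$ evaluated at the content vector of $2\lambda$). -}

module Defs where

open import Data.Nat using (ℕ; zero; suc; _<_; _≥_) renaming (_*_ to _*ℕ_)
open import Data.Integer using (ℤ; +_; _+_; _-_)
open import Data.List using (List; []; _∷_; map)
open import Data.Nat.ListAction using (sum)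
open import Data.List.Relation.Unary.All using (All)
open import Data.List.Relation.Unary.Linked using (Linked)
open import Relation.Binary.PropositionalEquality using (_≡_)

record IsPartition (n : ℕ) (λs : List ℕ) : Set where
  field
    positive   : All (0 <_) λs
    decreasing : Linked _≥_ λs
    sums       : sum λs ≡ n

largestPart : List ℕ → ℕ
largestPart []      = 0
largestPart (m ∷ _) = m

double : List ℕ → List ℕ
double = map (2 *ℕ_)

-- sum of contents (j - i) of the boxes (i, j), j = 1..m, of a row i of length m
rowContents : ℕ → ℕ → ℤ
rowContents i zero    = + 0
rowContents i (suc m) = rowContents i m + (+ suc m - + i)

-- sum of contents of all boxes of a diagram whose rows (top to bottom) have the
-- given lengths, the first listed row being row i
contentsFrom : ℕ → List ℕ → ℤ
contentsFrom i []       = + 0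
contentsFrom i (m ∷ ms) = rowContents i m + contentsFrom (suc i) ms

p1 : List ℕ → ℤ
p1 λs = contentsFrom 1 (double λs)

{-# OPTIONS --safe #-}
-- Splitting each content j − i into its column index j and its row index i gives
-- p₁(λ) = Σᵢ λᵢ(2λᵢ + 1) − Σᵢ 2iλᵢ, so bounds on p₁ become inequalities in ℕ.
-- Doubled rows of total length 2s, the first of them being row i, have content sum at least
-- s(4 − 2i − s), with equality for a column of dominoes: putting a row of length 2m, m ≥ 1,
-- on top of rows of total length 2t adds (m − 1)(3m + 2t) ≥ 0 to the slack.  For i = 1 this
-- is (2).  For (1), apply it with i = 2 to the rows below the first: with a = λ₁ and
-- r = n − λ₁ < a, p₁(λ) ≥ a(2a − 1) − r², and 4(a(2a − 1) − r²) − (a + r)² equals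
-- (a − r)(7a + 5r) − 4a > 0.
module Submission where

open import Defs
open import Data.Nat using (ℕ; _<_; _*_)
open import Data.Integer using (+_; -_; _+_) renaming (_<_ to _<ℤ_; _≤_ to _≤ℤ_; _*_ to _*ℤ_)
open import Data.List using (List)
open import Data.Product using (_×_)

open import Data.Nat as ℕ using (zero; suc; z≤n)
import Data.Nat.Properties as ℕ
open import Data.Nat.ListAction using (sum)
import Data.Nat.Tactic.RingSolver as ℕ-Solver
open import Data.Integer as ℤ using (ℤ; _-_)
import Data.Integer.Properties as ℤ
import Data.Integer.Tactic.RingSolver as ℤ-Solver
open import Data.List using ([]; _∷_)
open import Data.List.Relation.Unary.All using (All; []; _∷_)
open import Data.Product using (_,_)
open import Relation.Binary.PropositionalEquality

triangle : ℕ → ℕ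
triangle zero    = 0
triangle (suc k) = triangle k ℕ.+ suc k

triangle-double : ∀ m → triangle (2 * m) ≡ m * (2 * m ℕ.+ 1)
triangle-double zero    = refl
triangle-double (suc m) = begin
  triangle (2 * suc m)
    ≡⟨ cong triangle (ℕ.*-suc 2 m) ⟩
  triangle (2 * m) ℕ.+ suc (2 * m) ℕ.+ suc (suc (2 * m))
    ≡⟨ cong (λ x → x ℕ.+ suc (2 * m) ℕ.+ suc (suc (2 * m))) (triangle-double m) ⟩
  m * (2 * m ℕ.+ 1) ℕ.+ suc (2 * m) ℕ.+ suc (suc (2 * m))
    ≡⟨ expand m ⟩
  suc m * (2 * suc m ℕ.+ 1)
    ∎
  where
  open ≡-Reasoning
  expand : ∀ m → m * (2 * m ℕ.+ 1) ℕ.+ suc (2 * m) ℕ.+ suc (suc (2 * m)) ≡ suc m * (2 * suc m ℕ.+ 1)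
  expand = ℕ-Solver.solve-∀

rowContents-+-i*m≡triangle : ∀ i m → rowContents i m + + (i * m) ≡ + triangle m
rowContents-+-i*m≡triangle i zero    = cong (λ x → + 0 + + x) (ℕ.*-zeroʳ i)
rowContents-+-i*m≡triangle i (suc m) = begin
  rowContents i m + (+ suc m - + i) + + (i * suc m)
    ≡⟨ cong (_+_ (rowContents i m + (+ suc m - + i))) (trans (cong +_ (ℕ.*-suc i m)) (ℤ.pos-+ i (i * m))) ⟩
  rowContents i m + (+ suc m - + i) + (+ i + + (i * m))
    ≡⟨ regroup (rowContents i m) (+ suc m) (+ i) (+ (i * m)) ⟩
  rowContents i m + + (i * m) + + suc m
    ≡⟨ cong (_+ + suc m) (rowContents-+-i*m≡triangle i m) ⟩
  + triangle m + + suc m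
    ≡⟨ ℤ.pos-+ (triangle m) (suc m) ⟨
  + triangle (suc m)
    ∎
  where
  open ≡-Reasoning
  regroup : ∀ (c j i d : ℤ) → c + (j - i) + (i + d) ≡ c + d + j
  regroup = ℤ-Solver.solve-∀

rowIndexSum : ℕ → List ℕ → ℕ
rowIndexSum i []       = 0
rowIndexSum i (m ∷ ms) = i * m ℕ.+ rowIndexSum (suc i) ms

columnIndexSum : List ℕ → ℕ
columnIndexSum []       = 0
columnIndexSum (m ∷ ms) = triangle m ℕ.+ columnIndexSum ms

contentsFrom-+-rowIndexSum≡columnIndexSum :
  ∀ i ms → contentsFrom i ms + + rowIndexSum i ms ≡ + columnIndexSum ms
contentsFrom-+-rowIndexSum≡columnIndexSum i []       = refl
contentsFrom-+-rowIndexSum≡columnIndexSum i (m ∷ ms) = begin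
  rowContents i m + contentsFrom (suc i) ms + + (i * m ℕ.+ rowIndexSum (suc i) ms)
    ≡⟨ cong (_+_ (rowContents i m + contentsFrom (suc i) ms)) (ℤ.pos-+ (i * m) (rowIndexSum (suc i) ms)) ⟩
  rowContents i m + contentsFrom (suc i) ms + (+ (i * m) + + rowIndexSum (suc i) ms)
    ≡⟨ interchange (rowContents i m) (contentsFrom (suc i) ms) (+ (i * m)) (+ rowIndexSum (suc i) ms) ⟩
  (rowContents i m + + (i * m)) + (contentsFrom (suc i) ms + + rowIndexSum (suc i) ms)
    ≡⟨ cong₂ _+_ (rowContents-+-i*m≡triangle i m) (contentsFrom-+-rowIndexSum≡columnIndexSum (suc i) ms) ⟩
  + triangle m + + columnIndexSum ms
    ≡⟨ ℤ.pos-+ (triangle m) (columnIndexSum ms) ⟨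
  + columnIndexSum (m ∷ ms)
    ∎
  where
  open ≡-Reasoning
  interchange : ∀ (a b c d : ℤ) → a + b + (c + d) ≡ (a + c) + (b + d)
  interchange = ℤ-Solver.solve-∀

rowIndexSum-double-bound : ∀ i ms → All (0 <_) ms →
  4 * sum ms ℕ.+ rowIndexSum i (double ms)
    ℕ.≤ 2 * i * sum ms ℕ.+ sum ms * sum ms ℕ.+ columnIndexSum (double ms)
rowIndexSum-double-bound i []           []       = z≤n
rowIndexSum-double-bound i (suc k ∷ ms) (_ ∷ ps) = begin
  4 * (m ℕ.+ t) ℕ.+ (i * (2 * m) ℕ.+ R)
    ≡⟨ split-off-top-row m t i R ⟩
  4 * m ℕ.+ 2 * i * m ℕ.+ (4 * t ℕ.+ R)
    ≤⟨ ℕ.+-monoʳ-≤ (4 * m ℕ.+ 2 * i * m) (rowIndexSum-double-bound (suc i) ms ps) ⟩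
  4 * m ℕ.+ 2 * i * m ℕ.+ (2 * suc i * t ℕ.+ t * t ℕ.+ C)
    ≤⟨ ℕ.m≤m+n _ (k * (3 * m ℕ.+ 2 * t)) ⟩
  4 * m ℕ.+ 2 * i * m ℕ.+ (2 * suc i * t ℕ.+ t * t ℕ.+ C) ℕ.+ k * (3 * m ℕ.+ 2 * t)
    ≡⟨ absorb-slack k t i C ⟩
  2 * i * (m ℕ.+ t) ℕ.+ (m ℕ.+ t) * (m ℕ.+ t) ℕ.+ (m * (2 * m ℕ.+ 1) ℕ.+ C)
    ≡⟨ cong (λ x → 2 * i * (m ℕ.+ t) ℕ.+ (m ℕ.+ t) * (m ℕ.+ t) ℕ.+ (x ℕ.+ C)) (triangle-double m) ⟨
  2 * i * (m ℕ.+ t) ℕ.+ (m ℕ.+ t) * (m ℕ.+ t) ℕ.+ (triangle (2 * m) ℕ.+ C)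
    ∎
  where
  open ℕ.≤-Reasoning
  m = suc k
  t = sum ms
  R = rowIndexSum (suc i) (double ms)
  C = columnIndexSum (double ms)
  split-off-top-row : ∀ m t i R →
    4 * (m ℕ.+ t) ℕ.+ (i * (2 * m) ℕ.+ R) ≡ 4 * m ℕ.+ 2 * i * m ℕ.+ (4 * t ℕ.+ R)
  split-off-top-row = ℕ-Solver.solve-∀
  absorb-slack : ∀ k t i C →
    4 * suc k ℕ.+ 2 * i * suc k ℕ.+ (2 * suc i * t ℕ.+ t * t ℕ.+ C) ℕ.+ k * (3 * suc k ℕ.+ 2 * t)
      ≡ 2 * i * (suc k ℕ.+ t) ℕ.+ (suc k ℕ.+ t) * (suc k ℕ.+ t) ℕ.+ (suc k * (2 * suc k ℕ.+ 1) ℕ.+ C)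
  absorb-slack = ℕ-Solver.solve-∀

lowerBound-via-ℕ : ∀ {c q p} a b → c + + q ≡ + p → a ℕ.+ q ℕ.≤ b ℕ.+ p → - + b + + a ≤ℤ c
lowerBound-via-ℕ {c} {q} {p} a b offset a+q≤b+p = begin
  - + b + + a
    ≡⟨ shift (+ a) (+ b) (+ q) ⟩
  (+ a + + q) + (- + q - + b)
    ≡⟨ cong (_+ (- + q - + b)) (ℤ.pos-+ a q) ⟨
  + (a ℕ.+ q) + (- + q - + b)
    ≤⟨ ℤ.+-monoˡ-≤ (- + q - + b) (ℤ.+≤+ a+q≤b+p) ⟩
  + (b ℕ.+ p) + (- + q - + b)
    ≡⟨ cong (_+ (- + q - + b)) (trans (ℤ.pos-+ b p) (cong (_+_ (+ b)) (sym offset))) ⟩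
  (+ b + (c + + q)) + (- + q - + b)
    ≡⟨ cancel (+ b) c (+ q) ⟩
  c
    ∎
  where
  open ℤ.≤-Reasoning
  shift : ∀ (a b q : ℤ) → - b + a ≡ (a + q) + (- q - b)
  shift = ℤ-Solver.solve-∀
  cancel : ∀ (b c q : ℤ) → (b + (c + q)) + (- q - b) ≡ c
  cancel = ℤ-Solver.solve-∀

scale-offset : ∀ k {c q p} → c + + q ≡ + p → + k *ℤ c + + (k * q) ≡ + (k * p)
scale-offset k {c} {q} {p} offset = begin
  + k *ℤ c + + (k * q)      ≡⟨ cong (_+_ (+ k *ℤ c)) (ℤ.pos-* k q) ⟩
  + k *ℤ c + + k *ℤ + q     ≡⟨ ℤ.*-distribˡ-+ (+ k) c (+ q) ⟨
  + k *ℤ (c + + q)          ≡⟨ cong (+ k *ℤ_) offset ⟩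
  + k *ℤ + p                ≡⟨ ℤ.pos-* k p ⟨
  + (k * p)                 ∎
  where open ≡-Reasoning

dominant-row-bound : ∀ {a r} → r < a →
  suc ((a ℕ.+ r) * (a ℕ.+ r)) ℕ.+ 4 * (2 * a ℕ.+ r * r) ℕ.≤ 4 * (a * (2 * a ℕ.+ 1))
dominant-row-bound {r = r} r<a with d , refl ← ℕ.m≤n⇒∃[o]m+o≡n r<a =
  subst (lhs ℕ.≤_) (absorb-slack r d) (ℕ.m≤m+n lhs _)
  where
  lhs = suc ((suc r ℕ.+ d ℕ.+ r) * (suc r ℕ.+ d ℕ.+ r)) ℕ.+ 4 * (2 * (suc r ℕ.+ d) ℕ.+ r * r)
  absorb-slack : ∀ r d → let a = suc r ℕ.+ d in
    suc ((a ℕ.+ r) * (a ℕ.+ r)) ℕ.+ 4 * (2 * a ℕ.+ r * r)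
      ℕ.+ (2 ℕ.+ 8 * r ℕ.+ 10 * d ℕ.+ 7 * d * d ℕ.+ 12 * r * d)
      ≡ 4 * (a * (2 * a ℕ.+ 1))
  absorb-slack = ℕ-Solver.solve-∀

partition-indexSum-bound : ∀ {n λs} → IsPartition n λs →
  2 * n ℕ.+ rowIndexSum 1 (double λs) ℕ.≤ n * n ℕ.+ columnIndexSum (double λs)
partition-indexSum-bound {λs = λs} record { positive = ps ; sums = refl } =
  ℕ.+-cancelˡ-≤ (2 * s) _ _
    (subst₂ ℕ._≤_ (regroupˡ s R) (regroupʳ s C) (rowIndexSum-double-bound 1 λs ps))
  where
  s = sum λs
  R = rowIndexSum 1 (double λs)
  C = columnIndexSum (double λs)
  regroupˡ : ∀ s R → 4 * s ℕ.+ R ≡ 2 * s ℕ.+ (2 * s ℕ.+ R)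
  regroupˡ = ℕ-Solver.solve-∀
  regroupʳ : ∀ s C → 2 * s ℕ.+ s * s ℕ.+ C ≡ 2 * s ℕ.+ (s * s ℕ.+ C)
  regroupʳ s C = ℕ.+-assoc (2 * s) (s * s) C

dominant-partition-indexSum-bound : ∀ {n λs} → IsPartition n λs → n < 2 * largestPart λs →
  suc (n * n) ℕ.+ 4 * rowIndexSum 1 (double λs) ℕ.≤ 4 * columnIndexSum (double λs)
dominant-partition-indexSum-bound {λs = a ∷ rest} record { positive = _ ∷ ps ; sums = refl } n<2a = begin
  suc N ℕ.+ 4 * (1 * (2 * a) ℕ.+ R)
    ≤⟨ ℕ.+-monoʳ-≤ (suc N) (ℕ.*-monoʳ-≤ 4 (ℕ.+-monoʳ-≤ (1 * (2 * a)) tail-bound)) ⟩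
  suc N ℕ.+ 4 * (1 * (2 * a) ℕ.+ (r * r ℕ.+ C))
    ≡⟨ regroup N a r C ⟩
  suc N ℕ.+ 4 * (2 * a ℕ.+ r * r) ℕ.+ 4 * C
    ≤⟨ ℕ.+-monoˡ-≤ (4 * C) (dominant-row-bound r<a) ⟩
  4 * (a * (2 * a ℕ.+ 1)) ℕ.+ 4 * C
    ≡⟨ ℕ.*-distribˡ-+ 4 (a * (2 * a ℕ.+ 1)) C ⟨
  4 * (a * (2 * a ℕ.+ 1) ℕ.+ C)
    ≡⟨ cong (λ x → 4 * (x ℕ.+ C)) (triangle-double a) ⟨
  4 * (triangle (2 * a) ℕ.+ C)
    ∎
  where
  open ℕ.≤-Reasoning
  r = sum rest
  N = (a ℕ.+ r) * (a ℕ.+ r)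
  R = rowIndexSum 2 (double rest)
  C = columnIndexSum (double rest)
  r<a : r < a
  r<a = ℕ.+-cancelˡ-< a r a (subst (a ℕ.+ r <_) (cong (a ℕ.+_) (ℕ.+-identityʳ a)) n<2a)
  tail-bound : R ℕ.≤ r * r ℕ.+ C
  tail-bound = ℕ.+-cancelˡ-≤ (4 * r) _ _
    (subst (4 * r ℕ.+ R ℕ.≤_) (ℕ.+-assoc (4 * r) (r * r) C) (rowIndexSum-double-bound 2 rest ps))
  regroup : ∀ N a r C →
    suc N ℕ.+ 4 * (1 * (2 * a) ℕ.+ (r * r ℕ.+ C)) ≡ suc N ℕ.+ 4 * (2 * a ℕ.+ r * r) ℕ.+ 4 * C
  regroup = ℕ-Solver.solve-∀

lemma4p4 : ((n : ℕ) (λs : List ℕ) → IsPartition n λs →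
               n < 2 * largestPart λs → + (n * n) <ℤ + 4 *ℤ p1 λs)
             × ((n : ℕ) (λs : List ℕ) → IsPartition n λs →
               - + (n * n) + + (2 * n) ≤ℤ p1 λs)
lemma4p4 = dominant , general
  where
  p1-offset : ∀ λs → p1 λs + + rowIndexSum 1 (double λs) ≡ + columnIndexSum (double λs)
  p1-offset λs = contentsFrom-+-rowIndexSum≡columnIndexSum 1 (double λs)

  dominant : ∀ n λs → IsPartition n λs → n < 2 * largestPart λs → + (n * n) <ℤ + 4 *ℤ p1 λs
  dominant n λs part n<2λ₁ = ℤ.suc[i]≤j⇒i<j
    (lowerBound-via-ℕ (suc (n * n)) 0 (scale-offset 4 {p1 λs} (p1-offset λs))
      (dominant-partition-indexSum-bound part n<2λ₁))

  general : ∀ n λs → IsPartition n λs → - + (n * n) + + (2 * n) ≤ℤ p1 λs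
  general n λs part = lowerBound-via-ℕ (2 * n) (n * n) (p1-offset λs) (partition-indexSum-bound part)
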